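{- Let $\pi\in\mathbf I_n(3412)$. Then $\mathrm{inv}(\pi)=2A-t$, where $A$ is the area of the region between the path $\Psi(\pi)$ and the $x$-axis and $t$ is the number of non-trivial tunnels of $\Psi(\pi)$.
   Context: $\mathbf I_n(3412)$ is the set of involutions of $\{1,\dots,n\}$ with no subsequence order-isomorphic to $3412$. $\mathrm{inv}(\pi)$ is the number of pairs $i<j$ with $\pi_i>\pi_j$. For an involution $\pi$, $\Psi(\pi)$ is the Motzkin path $d_1\cdots d_n$ (steps $U=(1,1)$, $D=(1,-1)$, $H=(1,0)$, from $(0,0)$ to $(n,0)$, weakly above the $x$-axis) with $d_i=H$ if $i$ is a fixed point, $d_i=U$ if $i$ is the smaller element of a 2-cycle, $d_i=D$ if $i$ is the larger element of a 2-cycle. A tunnel of a Motzkin path $d$ is a horizontal segment between two lattice points of $d$, lying weakly below $d$, and containing exactly two lattice points of $d$; each horizontal step is a tunnel, called a trivial tunnel; the other tunnels are non-trivial. -}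

module Defs where

open import Data.Nat as ℕ using (ℕ; zero; suc; _+_; _∸_)
open import Data.Fin as F using (Fin; toℕ)
open import Data.Fin.Properties as FP using ()
open import Data.Integer as ℤ using (ℤ; +_; -[1+_]; 0ℤ; 1ℤ; -1ℤ)
open import Data.Integer.Properties as ZP using ()
open import Data.List using (List; []; _∷_; map; sum; length; filter; take; upTo; allFin; concatMap; foldr)
open import Data.List.Relation.Unary.All using (All; all?)
open import Data.Product using (Σ; _×_; _,_; ∃)
open import Relation.Nullary using (¬_; Dec; yes; no)
open import Relation.Nullary.Decidable using (_×-dec_)
open import Relation.Binary.PropositionalEquality using (_≡_)

-- Permutations/maps of {1,…,n} are modelled on Fin n (0-based; order is preserved).
IsInvolution : {n : ℕ} → (Fin n → Fin n) → Set
IsInvolution π = ∀ i → π (π i) ≡ i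

Contains3412 : {n : ℕ} → (Fin n → Fin n) → Set
Contains3412 {n} π =
  Σ (Fin n) λ a → Σ (Fin n) λ b → Σ (Fin n) λ c → Σ (Fin n) λ d →
    (a F.< b) × (b F.< c) × (c F.< d) ×
    (π c F.< π d) × (π d F.< π a) × (π a F.< π b)

Avoids3412 : {n : ℕ} → (Fin n → Fin n) → Set
Avoids3412 π = ¬ Contains3412 π

pairs : (n : ℕ) → List (Fin n × Fin n)
pairs n = concatMap (λ i → map (λ j → (i , j)) (allFin n)) (allFin n)

inv : {n : ℕ} → (Fin n → Fin n) → ℕ
inv {n} π = length (filter (λ { (i , j) → (i FP.<? j) ×-dec (π j FP.<? π i) }) (pairs n))

data Step : Set where
  U D H : Step

stepOf : {n : ℕ} → (Fin n → Fin n) → Fin n → Step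
stepOf π i with π i FP.≟ i
... | yes _ = H
... | no _ with i FP.<? π i
...   | yes _ = U
...   | no _ = D

Ψ : {n : ℕ} → (Fin n → Fin n) → List Step
Ψ {n} π = map (stepOf π) (allFin n)

stepVal : Step → ℤ
stepVal U = 1ℤ
stepVal D = -1ℤ
stepVal H = 0ℤ

-- height of the k-th lattice point (k , height d k) of the path d, k = 0,…,length d
height : List Step → ℕ → ℤ
height d k = foldr ℤ._+_ 0ℤ (map stepVal (take k d))

-- Twice the area between the path and the x-axis: the region under the step
-- from (k , h_k) to (k+1 , h_{k+1}) is a trapezoid of area (h_k + h_{k+1})/2.
twiceArea : List Step → ℤ
twiceArea d = foldr ℤ._+_ 0ℤ (map (λ k → height d k ℤ.+ height d (suc k)) (upTo (length d)))

between : ℕ → ℕ → List ℕ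
between i j = map (λ m → suc i + m) (upTo (j ∸ suc i))

-- The horizontal segment from the lattice point (i , h_i) to (j , h_j), i < j, is a tunnel
-- iff h_i = h_j and it lies weakly below d and contains no other lattice point of d,
-- i.e. h_k > h_i for all i < k < j. It is non-trivial iff it is not a single H step,
-- i.e. iff i + 2 ≤ j.
NonTrivialTunnel : List Step → ℕ → ℕ → Set
NonTrivialTunnel d i j =
  (2 + i ℕ.≤ j) × (height d i ≡ height d j) × All (λ k → height d i ℤ.< height d k) (between i j)

nonTrivialTunnel? : (d : List Step) → (i j : ℕ) → Dec (NonTrivialTunnel d i j)
nonTrivialTunnel? d i j =
  (2 + i ℕ.≤? j) ×-dec (height d i ZP.≟ height d j) ×-dec
    all? (λ k → height d i ZP.<? height d k) (between i j)

latticePairs : ℕ → List (ℕ × ℕ)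
latticePairs n = concatMap (λ i → map (λ j → (i , j)) (upTo (suc n))) (upTo (suc n))

-- number of non-trivial tunnels of d (lattice points have x-coordinates 0,…,length d)
nonTrivialTunnels : List Step → ℕ
nonTrivialTunnels d =
  length (filter (λ { (i , j) → nonTrivialTunnel? d i j }) (latticePairs (length d)))

-- View π as a set of arcs a ⌒ π a (a < π a) plus fixed points.  For an
-- involution, an occurrence of 3412 is a pair of crossing arcs, so the arcs of π
-- nest (`nesting`).  Let arcsOver k be the number of arcs with a < k ≤ π a.
--  * The height of Ψ(π) at abscissa k is arcsOver k (`height-Ψ`), so
--    2A = 2 · Σₖ arcsOver k (`twiceArea-Ψ`).
--  * The non-trivial tunnels of Ψ(π) are the segments from a to π a + 1, one per
--    arc (`arc⇒Tunnel`, `Tunnel⇒arc`), so t = #arcs (`nonTrivialTunnels-Ψ`).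
--  * By nesting, i < j is an inversion iff j lies under the arc leaving i or i
--    lies under the arc entering j, never both (`inversion-split`).  Counting
--    these pairs arc by arc gives inv(π) + #arcs = 2 · Σₖ arcsOver k
--    (`inversions+downs`).
module Submission where

open import Defs
open import Data.Nat as ℕ using (ℕ; zero; suc; _+_; _∸_; _≤_; _<_; z≤n; s≤s; _<?_; _≤?_)
open import Data.Nat.Properties using (module ≤-Reasoning; +-0-commutativeMonoid;
  ≤-refl; ≤-reflexive; ≤-trans; <-trans; <-irrefl; <-asym; <-cmp; <⇒≤; ≤-<-trans; <-≤-trans;
  +-mono-≤; +-mono-<-≤; +-identityʳ; +-comm; m≤n⇒m<n∨m≡n; ≮⇒≥; n≮0; m<n⇒m<1+n; ≤∧≢⇒<;
  m≤m+n; m≤n+m; n≤1+n; n<1+n; +-monoʳ-<; m+[n∸m]≡n; ∸-monoˡ-<; m∸n≢0⇒n<m)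
open import Data.Fin as F using (Fin; toℕ; fromℕ<)
import Data.Fin.Properties as FP
open import Data.Fin.Permutation using (permutation)
open import Data.Integer as ℤ using (ℤ; +_; _-_; 0ℤ)
import Data.Integer.Properties as ℤP
open import Data.List as L using (List; []; _∷_; map; length; filter; upTo; allFin; applyUpTo; tabulate; concatMap; foldr)
import Data.List.Properties as LP
open import Data.Nat.ListAction using () renaming (sum to listSum)
open import Data.List.Relation.Unary.All using (All)
import Data.List.Relation.Unary.All.Properties as AllP
open import Data.Product using (_×_; _,_; proj₁; proj₂)
open import Data.Sum using (_⊎_; inj₁; inj₂)
open import Data.Empty using (⊥; ⊥-elim)
open import Function using (_∘_)
open import Relation.Nullary using (¬_; Dec; yes; no; _×-dec_)
open import Relation.Binary.Definitions using (tri<; tri≈; tri>)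
open import Relation.Binary.PropositionalEquality
  using (_≡_; _≢_; refl; sym; trans; cong; cong₂; subst; subst₂; module ≡-Reasoning)
open import Algebra.Properties.CommutativeMonoid.Sum +-0-commutativeMonoid
  using (sum-syntax; sum-cong-≗; sum-remove; sum-init-last; ∑-comm; ∑-distrib-+; ∑-permute)

private variable
  P Q R : Set

𝟙 : Dec P → ℕ
𝟙 (yes _) = 1
𝟙 (no _) = 0

𝟙-yes : P → (p? : Dec P) → 𝟙 p? ≡ 1
𝟙-yes x (yes _) = refl
𝟙-yes x (no ¬x) = ⊥-elim (¬x x)

𝟙-no : ¬ P → (p? : Dec P) → 𝟙 p? ≡ 0
𝟙-no ¬x (yes x) = ⊥-elim (¬x x)
𝟙-no ¬x (no _) = refl

𝟙-cong : (P → Q) → (Q → P) → (p? : Dec P) (q? : Dec Q) → 𝟙 p? ≡ 𝟙 q?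
𝟙-cong to from (yes x) q? = sym (𝟙-yes (to x) q?)
𝟙-cong to from (no ¬x) q? = sym (𝟙-no (¬x ∘ from) q?)

𝟙-⊎ : (P → Q ⊎ R) → (Q → P) → (R → P) → (Q → ¬ R) →
      (p? : Dec P) (q? : Dec Q) (r? : Dec R) → 𝟙 p? ≡ 𝟙 q? + 𝟙 r?
𝟙-⊎ split fromQ fromR disjoint p? (yes y) r? =
  trans (𝟙-yes (fromQ y) p?) (cong suc (sym (𝟙-no (disjoint y) r?)))
𝟙-⊎ {P = P} {R = R} split fromQ fromR disjoint p? (no ¬y) r? = 𝟙-cong toR fromR p? r?
  where
  toR : P → R
  toR x with split x
  ... | inj₁ y = ⊥-elim (¬y y)
  ... | inj₂ z = z

𝟙-mono : (P → Q) → (p? : Dec P) (q? : Dec Q) → 𝟙 p? ≤ 𝟙 q?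
𝟙-mono to (yes x) q? = ≤-reflexive (sym (𝟙-yes (to x) q?))
𝟙-mono to (no _) q? = z≤n

∑-zero : ∀ {n} {f : Fin n → ℕ} → (∀ i → f i ≡ 0) → ∑[ i < n ] f i ≡ 0
∑-zero {zero} vanish = refl
∑-zero {suc n} vanish = cong₂ _+_ (vanish F.zero) (∑-zero (vanish ∘ F.suc))

∑-supported-at : ∀ {n} (c : Fin n) {f : Fin n → ℕ} → (∀ i → i ≢ c → f i ≡ 0) → ∑[ i < n ] f i ≡ f c
∑-supported-at {suc n} c {f} vanish = begin
  ∑[ i < suc n ] f i                   ≡⟨ sum-remove {i = c} f ⟩
  f c + ∑[ i < n ] f (F.punchIn c i)   ≡⟨ cong (λ m → f c + m) (∑-zero (λ i → vanish _ (FP.punchInᵢ≢i c i))) ⟩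
  f c + 0                              ≡⟨ +-identityʳ (f c) ⟩
  f c                                  ∎
  where open ≡-Reasoning

∑-mono : ∀ {n} {f g : Fin n → ℕ} → (∀ i → f i ≤ g i) → ∑[ i < n ] f i ≤ ∑[ i < n ] g i
∑-mono {zero} f≤g = z≤n
∑-mono {suc n} f≤g = +-mono-≤ (f≤g F.zero) (∑-mono (f≤g ∘ F.suc))

∑∑-distrib-+ : ∀ {m n} (f g : Fin m → Fin n → ℕ) →
  ∑[ i < m ] ∑[ j < n ] (f i j + g i j) ≡ ∑[ i < m ] ∑[ j < n ] f i j + ∑[ i < m ] ∑[ j < n ] g i j
∑∑-distrib-+ {m} {n} f g =
  trans (sum-cong-≗ {m} (λ i → ∑-distrib-+ (f i) (g i)))
        (∑-distrib-+ (λ i → ∑[ j < n ] f i j) (λ i → ∑[ j < n ] g i j))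

∑-mono-< : ∀ {n} {f g : Fin n → ℕ} → (∀ i → f i ≤ g i) → (c : Fin n) → f c < g c →
           ∑[ i < n ] f i < ∑[ i < n ] g i
∑-mono-< {suc n} {f} {g} f≤g c fc<gc =
  subst₂ _<_ (sym (sum-remove {i = c} f)) (sym (sum-remove {i = c} g))
         (+-mono-<-≤ fc<gc (∑-mono (f≤g ∘ F.punchIn c)))

∑-involution : ∀ {n} (σ : Fin n → Fin n) → (∀ i → σ (σ i) ≡ i) →
               (f : Fin n → ℕ) → ∑[ i < n ] f (σ i) ≡ ∑[ i < n ] f i
∑-involution σ involutive f = sym (∑-permute f (permutation σ σ involutive involutive))

∑-shift : ∀ n (f : ℕ → ℕ) → ∑[ k < n ] f (suc (toℕ k)) + f 0 ≡ ∑[ k < n ] f (toℕ k) + f n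
∑-shift n f = begin
  ∑[ k < n ] f (suc (toℕ k)) + f 0                  ≡⟨ +-comm _ (f 0) ⟩
  ∑[ k < suc n ] f (toℕ k)                          ≡⟨ sum-init-last (f ∘ toℕ) ⟩
  ∑[ k < n ] f (toℕ (F.inject₁ k)) + f (toℕ (F.fromℕ n))
    ≡⟨ cong₂ _+_ (sum-cong-≗ {n} (cong f ∘ FP.toℕ-inject₁)) (cong f (FP.toℕ-fromℕ n)) ⟩
  ∑[ k < n ] f (toℕ k) + f n                        ∎
  where open ≡-Reasoning

module _ {A : Set} {P : A → Set} (P? : (x : A) → Dec (P x)) where

  count-map : ∀ {B : Set} (g : B → A) xs → length (filter P? (map g xs)) ≡ listSum (map (𝟙 ∘ P? ∘ g) xs)
  count-map g [] = refl
  count-map g (x ∷ xs) with P? (g x)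
  ... | yes _ = cong suc (count-map g xs)
  ... | no _ = count-map g xs

  count-concatMap : ∀ {B : Set} (f : B → List A) xs →
                    length (filter P? (concatMap f xs)) ≡ listSum (map (λ x → length (filter P? (f x))) xs)
  count-concatMap f [] = refl
  count-concatMap f (x ∷ xs) = begin
    length (filter P? (f x L.++ concatMap f xs))            ≡⟨ cong length (LP.filter-++ P? (f x) _) ⟩
    length (filter P? (f x) L.++ filter P? (concatMap f xs)) ≡⟨ LP.length-++ (filter P? (f x)) ⟩
    length (filter P? (f x)) + length (filter P? (concatMap f xs))
      ≡⟨ cong (λ m → length (filter P? (f x)) + m) (count-concatMap f xs) ⟩
    listSum (map (λ y → length (filter P? (f y))) (x ∷ xs))   ∎
    where open ≡-Reasoning

sum-tabulate : ∀ {n} {B : Set} (f : Fin n → B) (g : B → ℕ) → listSum (map g (tabulate f)) ≡ ∑[ i < n ] g (f i)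
sum-tabulate {zero} f g = refl
sum-tabulate {suc n} f g = cong (λ m → g (f F.zero) + m) (sum-tabulate (f ∘ F.suc) g)

sum-applyUpTo : ∀ m {B : Set} (f : ℕ → B) (g : B → ℕ) → listSum (map g (applyUpTo f m)) ≡ ∑[ i < m ] g (f (toℕ i))
sum-applyUpTo zero f g = refl
sum-applyUpTo (suc m) f g = cong (λ s → g (f 0) + s) (sum-applyUpTo m (f ∘ suc) g)

count-pairs : ∀ {n} {P : Fin n × Fin n → Set} (P? : ∀ x → Dec (P x)) →
              length (filter P? (pairs n)) ≡ ∑[ i < n ] ∑[ j < n ] 𝟙 (P? (i , j))
count-pairs {n} P? = begin
  length (filter P? (pairs n))
    ≡⟨ count-concatMap P? (λ i → map (i ,_) (allFin n)) (allFin n) ⟩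
  listSum (map (λ i → length (filter P? (map (i ,_) (allFin n)))) (allFin n))
    ≡⟨ sum-tabulate {n} (λ i → i) _ ⟩
  ∑[ i < n ] length (filter P? (map (i ,_) (allFin n)))
    ≡⟨ sum-cong-≗ {n} (λ i → trans (count-map P? (i ,_) (allFin n)) (sum-tabulate {n} (λ j → j) _)) ⟩
  ∑[ i < n ] ∑[ j < n ] 𝟙 (P? (i , j)) ∎
  where open ≡-Reasoning

count-latticePairs : ∀ m {P : ℕ × ℕ → Set} (P? : ∀ x → Dec (P x)) →
  length (filter P? (latticePairs m)) ≡ ∑[ i < suc m ] ∑[ j < suc m ] 𝟙 (P? (toℕ i , toℕ j))
count-latticePairs m P? = begin
  length (filter P? (latticePairs m))
    ≡⟨ count-concatMap P? (λ i → map (i ,_) (upTo (suc m))) (upTo (suc m)) ⟩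
  listSum (map (λ i → length (filter P? (map (i ,_) (upTo (suc m))))) (upTo (suc m)))
    ≡⟨ sum-applyUpTo (suc m) (λ i → i) _ ⟩
  ∑[ i < suc m ] length (filter P? (map (toℕ i ,_) (upTo (suc m))))
    ≡⟨ sum-cong-≗ {suc m} (λ i → trans (count-map P? (toℕ i ,_) (upTo (suc m))) (sum-applyUpTo (suc m) (λ j → j) _)) ⟩
  ∑[ i < suc m ] ∑[ j < suc m ] 𝟙 (P? (toℕ i , toℕ j)) ∎
  where open ≡-Reasoning

foldr-upTo : ∀ m (g : ℕ → ℤ) (f : ℕ → ℕ) → (∀ {k} → k < m → g k ≡ + f k) →
             foldr ℤ._+_ 0ℤ (map g (upTo m)) ≡ + ∑[ k < m ] f (toℕ k)
foldr-upTo m g f g≡f = begin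
  foldr ℤ._+_ 0ℤ (map g (upTo m))         ≡⟨ cong (foldr ℤ._+_ 0ℤ) (LP.map-cong-local (AllP.applyUpTo⁺₁ (λ k → k) m g≡f)) ⟩
  foldr ℤ._+_ 0ℤ (map (+_ ∘ f) (upTo m))  ≡⟨ pos-sum (upTo m) ⟩
  + listSum (map f (upTo m))                ≡⟨ cong +_ (sum-applyUpTo m (λ k → k) f) ⟩
  + ∑[ k < m ] f (toℕ k)                  ∎
  where
  open ≡-Reasoning
  pos-sum : ∀ xs → foldr ℤ._+_ 0ℤ (map (+_ ∘ f) xs) ≡ + listSum (map f xs)
  pos-sum [] = refl
  pos-sum (x ∷ xs) = trans (cong (λ z → + f x ℤ.+ z) (pos-sum xs)) (sym (ℤP.pos-+ (f x) _))

height-tabulate-suc : ∀ {n} (s : Fin n → Step) (k : Fin n) →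
  height (tabulate s) (suc (toℕ k)) ≡ height (tabulate s) (toℕ k) ℤ.+ stepVal (s k)
height-tabulate-suc s F.zero = ℤP.+-comm (stepVal (s F.zero)) 0ℤ
height-tabulate-suc s (F.suc k) = begin
  stepVal (s F.zero) ℤ.+ height (tabulate (s ∘ F.suc)) (suc (toℕ k))
    ≡⟨ cong (λ h → stepVal (s F.zero) ℤ.+ h) (height-tabulate-suc (s ∘ F.suc) k) ⟩
  stepVal (s F.zero) ℤ.+ (height (tabulate (s ∘ F.suc)) (toℕ k) ℤ.+ stepVal (s (F.suc k)))
    ≡⟨ sym (ℤP.+-assoc (stepVal (s F.zero)) _ _) ⟩
  stepVal (s F.zero) ℤ.+ height (tabulate (s ∘ F.suc)) (toℕ k) ℤ.+ stepVal (s (F.suc k)) ∎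
  where open ≡-Reasoning

module _ {P : ℕ → Set} (i j : ℕ) where

  all-between⁻ : All P (between i j) → ∀ k → i < k → k < j → P k
  all-between⁻ all k i<k k<j =
    subst P (m+[n∸m]≡n i<k)
      (AllP.applyUpTo⁻ (λ m → suc i + m) (j ∸ suc i) (subst (All P) (LP.map-upTo _ _) all) (∸-monoˡ-< k<j i<k))

  all-between⁺ : (∀ k → i < k → k < j → P k) → All P (between i j)
  all-between⁺ inside = subst (All P) (sym (LP.map-upTo _ _)) (AllP.applyUpTo⁺₁ _ (j ∸ suc i) bounds)
    where
    bounds : ∀ {m} → m < j ∸ suc i → P (suc i + m)
    bounds {m} m<r = inside (suc i + m) (s≤s (m≤m+n i m))
      (subst (suc i + m <_) (m+[n∸m]≡n {suc i} (<⇒≤ 1+i<j)) (+-monoʳ-< (suc i) m<r))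
      where
      1+i<j : suc i < j
      1+i<j = m∸n≢0⇒n<m (λ r≡0 → n≮0 (subst (m <_) r≡0 m<r))

Tunnel : (ℕ → ℕ) → ℕ → ℕ → Set
Tunnel f i j = (2 + i ≤ j) × (f i ≡ f j) × (∀ k → i < k → k < j → f i < f k)

module _ (d : List Step) (f : ℕ → ℕ) {m : ℕ} (height≡f : ∀ {k} → k ≤ m → height d k ≡ + f k) where

  private
    start≤m : ∀ {i j} → 2 + i ≤ j → j ≤ m → i ≤ m
    start≤m {i} 2+i≤j j≤m = ≤-trans (m≤n+m i 2) (≤-trans 2+i≤j j≤m)

  tunnel⇒Tunnel : ∀ {i j} → j ≤ m → NonTrivialTunnel d i j → Tunnel f i j
  tunnel⇒Tunnel {i} {j} j≤m (2+i≤j , hi≡hj , above) =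
    2+i≤j , ℤP.+-injective (trans (sym (height≡f i≤m)) (trans hi≡hj (height≡f j≤m))) , fAbove
    where
    i≤m : i ≤ m
    i≤m = start≤m 2+i≤j j≤m
    fAbove : ∀ k → i < k → k < j → f i < f k
    fAbove k i<k k<j = ℤP.drop‿+<+ (subst₂ ℤ._<_ (height≡f i≤m) (height≡f (<⇒≤ (<-≤-trans k<j j≤m)))
                                    (all-between⁻ i j above k i<k k<j))

  Tunnel⇒tunnel : ∀ {i j} → j ≤ m → Tunnel f i j → NonTrivialTunnel d i j
  Tunnel⇒tunnel {i} {j} j≤m (2+i≤j , fi≡fj , fAbove) =
    2+i≤j , trans (height≡f i≤m) (trans (cong +_ fi≡fj) (sym (height≡f j≤m))) , all-between⁺ i j above
    where
    i≤m : i ≤ m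
    i≤m = start≤m 2+i≤j j≤m
    above : ∀ k → i < k → k < j → height d i ℤ.< height d k
    above k i<k k<j = subst₂ ℤ._<_ (sym (height≡f i≤m)) (sym (height≡f (<⇒≤ (<-≤-trans k<j j≤m))))
                        (ℤ.+<+ (fAbove k i<k k<j))

module NonCrossing {n : ℕ} (π : Fin n → Fin n) (involutive : IsInvolution π) (avoids : Avoids3412 π) where

  π-injective : ∀ {a b} → π a ≡ π b → a ≡ b
  π-injective {a} {b} πa≡πb = trans (sym (involutive a)) (trans (cong π πa≡πb) (involutive b))

  -- Two arcs a ⌒ c and b ⌒ d never cross: crossing arcs are an occurrence of 3412.
  no-crossing : ∀ {a b c d} → a F.< b → b F.< c → c F.< d → π a ≡ c → π b ≡ d → ⊥
  no-crossing {a} {b} {c} {d} a<b b<c c<d πa≡c πb≡d =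
    avoids (a , b , c , d , a<b , b<c , c<d ,
            subst₂ F._<_ (sym πc≡a) (sym πd≡b) a<b ,
            subst₂ F._<_ (sym πd≡b) (sym πa≡c) b<c ,
            subst₂ F._<_ (sym πa≡c) (sym πb≡d) c<d)
    where
    πc≡a : π c ≡ a
    πc≡a = trans (cong π (sym πa≡c)) (involutive a)
    πd≡b : π d ≡ b
    πd≡b = trans (cong π (sym πb≡d)) (involutive b)

  nesting : ∀ {a b} → a F.< b → b F.< π a → a F.< π b × π b F.< π a
  nesting {a} {b} a<b b<πa with <-cmp (toℕ (π b)) (toℕ a)
  ... | tri< πb<a _ _ = ⊥-elim (no-crossing πb<a a<b b<πa (involutive b) refl)
  ... | tri≈ _ πb≡a _ = ⊥-elim (<-irrefl (cong toℕ b≡πa) b<πa)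
    where
    b≡πa : b ≡ π a
    b≡πa = trans (sym (involutive b)) (cong π (FP.toℕ-injective πb≡a))
  ... | tri> _ _ a<πb with <-cmp (toℕ (π b)) (toℕ (π a))
  ...   | tri< πb<πa _ _ = a<πb , πb<πa
  ...   | tri≈ _ πb≡πa _ = ⊥-elim (<-irrefl (cong toℕ (π-injective (sym (FP.toℕ-injective πb≡πa)))) a<b)
  ...   | tri> _ _ πa<πb = ⊥-elim (no-crossing a<b b<πa πa<πb refl refl)

  Spans : Fin n → ℕ → Set
  Spans a k = toℕ a < k × k ≤ toℕ (π a)

  spans? : ∀ a k → Dec (Spans a k)
  spans? a k = (toℕ a <? k) ×-dec (k ≤? toℕ (π a))

  arcsOver : ℕ → ℕ
  arcsOver k = ∑[ a < n ] 𝟙 (spans? a k)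

  up down : Fin n → ℕ
  up a = 𝟙 (a F.<? π a)
  down a = 𝟙 (π a F.<? a)

  EndsAt StartsAt : Fin n → Fin n → Set
  EndsAt a k = a F.< k × π a ≡ k
  StartsAt a k = a ≡ k × k F.< π a

  endsAt? : ∀ a k → Dec (EndsAt a k)
  endsAt? a k = (a F.<? k) ×-dec (π a FP.≟ k)

  startsAt? : ∀ a k → Dec (StartsAt a k)
  startsAt? a k = (a FP.≟ k) ×-dec (k F.<? π a)

  spans-suc : ∀ a k → 𝟙 (spans? a (suc (toℕ k))) + 𝟙 (endsAt? a k) ≡ 𝟙 (spans? a (toℕ k)) + 𝟙 (startsAt? a k)
  spans-suc a k with <-cmp (toℕ a) (toℕ k)
  ... | tri< a<k _ _ = begin
    𝟙 (spans? a (suc (toℕ k))) + 𝟙 (endsAt? a k)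
      ≡⟨ 𝟙-⊎ split stillSpans endSpans notBoth (spans? a (toℕ k)) (spans? a (suc (toℕ k))) (endsAt? a k) ⟨
    𝟙 (spans? a (toℕ k))                              ≡⟨ +-identityʳ _ ⟨
    𝟙 (spans? a (toℕ k)) + 0                          ≡⟨ cong (λ m → 𝟙 (spans? a (toℕ k)) + m) noStart ⟨
    𝟙 (spans? a (toℕ k)) + 𝟙 (startsAt? a k)          ∎
    where
    open ≡-Reasoning
    split : Spans a (toℕ k) → Spans a (suc (toℕ k)) ⊎ EndsAt a k
    split (_ , k≤πa) with m≤n⇒m<n∨m≡n k≤πa
    ... | inj₁ k<πa = inj₁ (m<n⇒m<1+n a<k , k<πa)
    ... | inj₂ k≡πa = inj₂ (a<k , FP.toℕ-injective (sym k≡πa))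
    stillSpans : Spans a (suc (toℕ k)) → Spans a (toℕ k)
    stillSpans (_ , k<πa) = a<k , <⇒≤ k<πa
    endSpans : EndsAt a k → Spans a (toℕ k)
    endSpans (_ , πa≡k) = a<k , ≤-reflexive (cong toℕ (sym πa≡k))
    notBoth : Spans a (suc (toℕ k)) → ¬ EndsAt a k
    notBoth (_ , k<πa) (_ , πa≡k) = <-irrefl (cong toℕ (sym πa≡k)) k<πa
    noStart : 𝟙 (startsAt? a k) ≡ 0
    noStart = 𝟙-no (λ (a≡k , _) → <-irrefl (cong toℕ a≡k) a<k) (startsAt? a k)
  ... | tri≈ _ a≡k _ = begin
    𝟙 (spans? a (suc (toℕ k))) + 𝟙 (endsAt? a k)
      ≡⟨ cong₂ _+_ (𝟙-cong (λ (_ , k<πa) → a≡k' , k<πa) (λ (_ , k<πa) → ≤-reflexive (cong suc a≡k) , k<πa)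
                           (spans? a (suc (toℕ k))) (startsAt? a k))
                   (𝟙-no (λ (a<k , _) → <-irrefl a≡k a<k) (endsAt? a k)) ⟩
    𝟙 (startsAt? a k) + 0                       ≡⟨ +-comm _ 0 ⟩
    0 + 𝟙 (startsAt? a k)
      ≡⟨ cong (_+ 𝟙 (startsAt? a k)) (𝟙-no (λ (a<k , _) → <-irrefl a≡k a<k) (spans? a (toℕ k))) ⟨
    𝟙 (spans? a (toℕ k)) + 𝟙 (startsAt? a k)    ∎
    where
    open ≡-Reasoning
    a≡k' : a ≡ k
    a≡k' = FP.toℕ-injective a≡k
  ... | tri> _ _ k<a = cong₂ _+_
    (trans (𝟙-no (λ (a≤k , _) → <-irrefl refl (<-≤-trans k<a (ℕ.s≤s⁻¹ a≤k))) (spans? a (suc (toℕ k))))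
           (sym (𝟙-no (λ (a<k , _) → <-asym a<k k<a) (spans? a (toℕ k)))))
    (trans (𝟙-no (λ (a<k , _) → <-asym a<k k<a) (endsAt? a k))
           (sym (𝟙-no (λ (a≡k , _) → <-irrefl (cong toℕ (sym a≡k)) k<a) (startsAt? a k))))

  arcsOver-suc : ∀ k → arcsOver (suc (toℕ k)) + down k ≡ arcsOver (toℕ k) + up k
  arcsOver-suc k = begin
    arcsOver (suc (toℕ k)) + down k
      ≡⟨ cong (λ m → arcsOver (suc (toℕ k)) + m) ending ⟨
    arcsOver (suc (toℕ k)) + ∑[ a < n ] 𝟙 (endsAt? a k)
      ≡⟨ ∑-distrib-+ (λ a → 𝟙 (spans? a (suc (toℕ k)))) (λ a → 𝟙 (endsAt? a k)) ⟨
    ∑[ a < n ] (𝟙 (spans? a (suc (toℕ k))) + 𝟙 (endsAt? a k))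
      ≡⟨ sum-cong-≗ {n} (λ a → spans-suc a k) ⟩
    ∑[ a < n ] (𝟙 (spans? a (toℕ k)) + 𝟙 (startsAt? a k))
      ≡⟨ ∑-distrib-+ (λ a → 𝟙 (spans? a (toℕ k))) (λ a → 𝟙 (startsAt? a k)) ⟩
    arcsOver (toℕ k) + ∑[ a < n ] 𝟙 (startsAt? a k)
      ≡⟨ cong (λ m → arcsOver (toℕ k) + m) starting ⟩
    arcsOver (toℕ k) + up k ∎
    where
    open ≡-Reasoning
    -- only the arc of π k can end at k, and only the arc of k can start there
    partner : ∀ {a} → π a ≡ k → a ≡ π k
    partner {a} πa≡k = π-injective (trans πa≡k (sym (involutive k)))
    ending : ∑[ a < n ] 𝟙 (endsAt? a k) ≡ down k
    ending = trans (∑-supported-at (π k) (λ a a≢πk → 𝟙-no (λ (_ , πa≡k) → a≢πk (partner πa≡k)) (endsAt? a k)))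
                   (𝟙-cong proj₁ (λ πk<k → πk<k , involutive k) (endsAt? (π k) k) (π k F.<? k))
    starting : ∑[ a < n ] 𝟙 (startsAt? a k) ≡ up k
    starting = trans (∑-supported-at k (λ a a≢k → 𝟙-no (λ (a≡k , _) → a≢k a≡k) (startsAt? a k)))
                     (𝟙-cong proj₂ (λ k<πk → refl , k<πk) (startsAt? k k) (k F.<? π k))

  arcsOver-0 : arcsOver 0 ≡ 0
  arcsOver-0 = ∑-zero (λ a → 𝟙-no (λ (a<0 , _) → n≮0 a<0) (spans? a 0))

  arcsOver-n : arcsOver n ≡ 0
  arcsOver-n = ∑-zero (λ a → 𝟙-no (λ (_ , n≤πa) → <-irrefl refl (≤-<-trans n≤πa (FP.toℕ<n (π a)))) (spans? a n))

  -- Every arc has one left end and one right end.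
  ∑up≡∑down : ∑[ a < n ] up a ≡ ∑[ a < n ] down a
  ∑up≡∑down = begin
    ∑[ a < n ] up a
      ≡⟨ sum-cong-≗ {n} (λ a → 𝟙-cong left→right right→left (a F.<? π a) (π (π a) F.<? π a)) ⟩
    ∑[ a < n ] down (π a)              ≡⟨ ∑-involution π involutive down ⟩
    ∑[ a < n ] down a                  ∎
    where
    open ≡-Reasoning
    left→right : ∀ {a} → a F.< π a → π (π a) F.< π a
    left→right {a} = subst (F._< π a) (sym (involutive a))
    right→left : ∀ {a} → π (π a) F.< π a → a F.< π a
    right→left {a} = subst (F._< π a) (involutive a)

  Inversion : Fin n → Fin n → Set
  Inversion i j = i F.< j × π j F.< π i

  inversion? : ∀ i j → Dec (Inversion i j)
  inversion? i j = (i F.<? j) ×-dec (π j F.<? π i)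

  inversion-split : ∀ {i j} → i F.< j →
    𝟙 (inversion? i j) ≡ 𝟙 (spans? i (toℕ j)) + 𝟙 (spans? (π j) (toℕ i))
  inversion-split {i} {j} i<j =
    𝟙-⊎ split underLeft underRight disjoint (inversion? i j) (spans? i (toℕ j)) (spans? (π j) (toℕ i))
    where
    i<ππj : i F.< π (π j)
    i<ππj = subst (i F.<_) (sym (involutive j)) i<j
    split : Inversion i j → Spans i (toℕ j) ⊎ Spans (π j) (toℕ i)
    split (_ , πj<πi) with toℕ j ≤? toℕ (π i)
    ... | yes j≤πi = inj₁ (i<j , j≤πi)
    ... | no j≰πi with <-cmp (toℕ (π j)) (toℕ i)
    ...   | tri< πj<i _ _ = inj₂ (πj<i , <⇒≤ i<ππj)
    ...   | tri≈ _ πj≡i _ = ⊥-elim (j≰πi (≤-reflexive (cong toℕ (sym πi≡j))))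
      where
      πi≡j : π i ≡ j
      πi≡j = trans (cong π (sym (FP.toℕ-injective πj≡i))) (involutive j)
    ...   | tri> _ _ i<πj = ⊥-elim (j≰πi (<⇒≤ (subst (F._< π i) (involutive j) (proj₂ (nesting i<πj πj<πi)))))
    underLeft : Spans i (toℕ j) → Inversion i j
    underLeft (_ , j≤πi) with m≤n⇒m<n∨m≡n j≤πi
    ... | inj₁ j<πi = i<j , proj₂ (nesting i<j j<πi)
    ... | inj₂ j≡πi = i<j , subst₂ F._<_ (sym πj≡i) (FP.toℕ-injective j≡πi) i<j
      where
      πj≡i : π j ≡ i
      πj≡i = trans (cong π (FP.toℕ-injective j≡πi)) (involutive i)
    underRight : Spans (π j) (toℕ i) → Inversion i j
    underRight (πj<i , _) = i<j , proj₁ (nesting πj<i i<ππj)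
    disjoint : Spans i (toℕ j) → ¬ Spans (π j) (toℕ i)
    disjoint (_ , j≤πi) (πj<i , _) =
      <-irrefl refl (≤-<-trans j≤πi (subst (π i F.<_) (involutive j) (proj₂ (nesting πj<i i<ππj))))

  DiagonalDown : Fin n → Fin n → Set
  DiagonalDown i j = i ≡ j × π j F.< j

  diagonalDown? : ∀ i j → Dec (DiagonalDown i j)
  diagonalDown? i j = (i FP.≟ j) ×-dec (π j F.<? j)

  -- Inversion-split extended to all pairs: on the diagonal only the arc entering
  -- j can span j, which happens exactly when j is a right end.
  pair-count : ∀ i j → 𝟙 (inversion? i j) + 𝟙 (diagonalDown? i j)
                      ≡ 𝟙 (spans? i (toℕ j)) + 𝟙 (spans? (π j) (toℕ i))
  pair-count i j with <-cmp (toℕ i) (toℕ j)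
  ... | tri< i<j _ _ = begin
    𝟙 (inversion? i j) + 𝟙 (diagonalDown? i j)
      ≡⟨ cong (λ m → 𝟙 (inversion? i j) + m) (𝟙-no (λ (i≡j , _) → <-irrefl (cong toℕ i≡j) i<j) (diagonalDown? i j)) ⟩
    𝟙 (inversion? i j) + 0                                   ≡⟨ +-identityʳ _ ⟩
    𝟙 (inversion? i j)                                       ≡⟨ inversion-split i<j ⟩
    𝟙 (spans? i (toℕ j)) + 𝟙 (spans? (π j) (toℕ i))          ∎
    where open ≡-Reasoning
  ... | tri≈ _ i≡j _ = cong₂ _+_
    (trans (𝟙-no (λ (i<j , _) → <-irrefl i≡j i<j) (inversion? i j))
           (sym (𝟙-no (λ (i<j , _) → <-irrefl i≡j i<j) (spans? i (toℕ j)))))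
    (𝟙-cong (λ (_ , πj<j) → subst (toℕ (π j) <_) (sym i≡j) πj<j , ≤-reflexive (trans i≡j (cong toℕ (sym (involutive j)))))
            (λ (πj<i , _) → FP.toℕ-injective i≡j , subst (toℕ (π j) <_) i≡j πj<i)
            (diagonalDown? i j) (spans? (π j) (toℕ i)))
  ... | tri> _ _ j<i = cong₂ _+_
    (trans (𝟙-no (λ (i<j , _) → <-asym i<j j<i) (inversion? i j))
           (sym (𝟙-no (λ (i<j , _) → <-asym i<j j<i) (spans? i (toℕ j)))))
    (trans (𝟙-no (λ (i≡j , _) → <-irrefl (cong toℕ (sym i≡j)) j<i) (diagonalDown? i j))
           (sym (𝟙-no (λ (_ , i≤ππj) → <-irrefl refl (<-≤-trans j<i (subst (toℕ i ≤_) (cong toℕ (involutive j)) i≤ππj)))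
                      (spans? (π j) (toℕ i)))))

  -- Summing pair-count over all pairs: each of the two spans-terms counts every
  -- pair (arc, spanned abscissa) once, by left and by right end respectively.
  inversions+downs : ∑[ i < n ] ∑[ j < n ] 𝟙 (inversion? i j) + ∑[ j < n ] down j
                     ≡ ∑[ k < n ] arcsOver (toℕ k) + ∑[ k < n ] arcsOver (toℕ k)
  inversions+downs = begin
    ∑[ i < n ] ∑[ j < n ] 𝟙 (inversion? i j) + ∑[ j < n ] down j
      ≡⟨ cong (λ m → ∑[ i < n ] ∑[ j < n ] 𝟙 (inversion? i j) + m) diagonal ⟨
    ∑[ i < n ] ∑[ j < n ] 𝟙 (inversion? i j) + ∑[ i < n ] ∑[ j < n ] 𝟙 (diagonalDown? i j)
      ≡⟨ ∑∑-distrib-+ (λ i j → 𝟙 (inversion? i j)) (λ i j → 𝟙 (diagonalDown? i j)) ⟨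
    ∑[ i < n ] ∑[ j < n ] (𝟙 (inversion? i j) + 𝟙 (diagonalDown? i j))
      ≡⟨ sum-cong-≗ {n} (λ i → sum-cong-≗ {n} (pair-count i)) ⟩
    ∑[ i < n ] ∑[ j < n ] (𝟙 (spans? i (toℕ j)) + 𝟙 (spans? (π j) (toℕ i)))
      ≡⟨ ∑∑-distrib-+ (λ i j → 𝟙 (spans? i (toℕ j))) (λ i j → 𝟙 (spans? (π j) (toℕ i))) ⟩
    ∑[ i < n ] ∑[ j < n ] 𝟙 (spans? i (toℕ j)) + ∑[ i < n ] ∑[ j < n ] 𝟙 (spans? (π j) (toℕ i))
      ≡⟨ cong₂ _+_ (∑-comm {n} {n} (λ i j → 𝟙 (spans? i (toℕ j))))
                   (sum-cong-≗ {n} (λ i → ∑-involution π involutive (λ a → 𝟙 (spans? a (toℕ i))))) ⟩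
    ∑[ k < n ] arcsOver (toℕ k) + ∑[ k < n ] arcsOver (toℕ k) ∎
    where
    open ≡-Reasoning
    diagonal : ∑[ i < n ] ∑[ j < n ] 𝟙 (diagonalDown? i j) ≡ ∑[ j < n ] down j
    diagonal = sum-cong-≗ {n} (λ i →
      trans (∑-supported-at i (λ j j≢i → 𝟙-no (λ (i≡j , _) → j≢i (sym i≡j)) (diagonalDown? i j)))
            (𝟙-cong proj₂ (λ πi<i → refl , πi<i) (diagonalDown? i i) (π i F.<? i)))

  enclosing : ∀ {a b} → a F.< π a → Spans b (toℕ a) → π a F.< π b
  enclosing {a} {b} a<πa (b<a , a≤πb) with m≤n⇒m<n∨m≡n a≤πb
  ... | inj₁ a<πb = proj₂ (nesting b<a a<πb)
  ... | inj₂ a≡πb = ⊥-elim (<-asym b<a (subst (a F.<_) (sym b≡πa) a<πa))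
    where
    b≡πa : b ≡ π a
    b≡πa = trans (sym (involutive b)) (cong π (sym (FP.toℕ-injective a≡πb)))

  arcsOver-after-arc : ∀ {a} → a F.< π a → arcsOver (suc (toℕ (π a))) ≡ arcsOver (toℕ a)
  arcsOver-after-arc {a} a<πa = sum-cong-≗ {n} (λ b → 𝟙-cong (spansAfter b) (spansBefore b)
                                                  (spans? b (suc (toℕ (π a)))) (spans? b (toℕ a)))
    where
    spansBefore : ∀ b → Spans b (toℕ a) → Spans b (suc (toℕ (π a)))
    spansBefore b spans@(b<a , _) = m<n⇒m<1+n (<-trans b<a a<πa) , enclosing a<πa spans
    spansAfter : ∀ b → Spans b (suc (toℕ (π a))) → Spans b (toℕ a)
    spansAfter b (b≤πa , πa<πb) with <-cmp (toℕ b) (toℕ a)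
    ... | tri< b<a _ _ = b<a , <⇒≤ (<-trans a<πa πa<πb)
    ... | tri≈ _ b≡a _ = ⊥-elim (<-irrefl (cong (toℕ ∘ π) (sym (FP.toℕ-injective b≡a))) πa<πb)
    ... | tri> _ _ a<b with m≤n⇒m<n∨m≡n (ℕ.s≤s⁻¹ b≤πa)
    ...   | inj₁ b<πa = ⊥-elim (<-asym πa<πb (proj₂ (nesting a<b b<πa)))
    ...   | inj₂ b≡πa = ⊥-elim (<-asym a<πa (subst (π a F.<_) πb≡a πa<πb))
      where
      πb≡a : π b ≡ a
      πb≡a = trans (cong π (FP.toℕ-injective b≡πa)) (involutive a)

  -- Strictly under an arc, more arcs span than at its left end (the arc itself).
  arcsOver-under-arc : ∀ {a k} → a F.< π a → toℕ a < k → k ≤ toℕ (π a) → arcsOver (toℕ a) < arcsOver k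
  arcsOver-under-arc {a} {k} a<πa a<k k≤πa =
    ∑-mono-< (λ b → 𝟙-mono (stillSpans b) (spans? b (toℕ a)) (spans? b k)) a ownArc
    where
    ownArc : 𝟙 (spans? a (toℕ a)) < 𝟙 (spans? a k)
    ownArc = subst₂ _<_ (sym (𝟙-no (λ (a<a , _) → <-irrefl refl a<a) (spans? a (toℕ a))))
                        (sym (𝟙-yes (a<k , k≤πa) (spans? a k))) (s≤s z≤n)
    stillSpans : ∀ b → Spans b (toℕ a) → Spans b k
    stillSpans b spans@(b<a , _) = <-trans b<a a<k , ≤-trans k≤πa (<⇒≤ (enclosing a<πa spans))

  -- At a right end (or fixed point) no arc starts, so no new arc spans.
  arcsOver-after-non-left-end : ∀ {a} → ¬ (a F.< π a) → arcsOver (suc (toℕ a)) ≤ arcsOver (toℕ a)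
  arcsOver-after-non-left-end {a} a≮πa = begin
    arcsOver (suc (toℕ a))            ≤⟨ m≤m+n _ (down a) ⟩
    arcsOver (suc (toℕ a)) + down a   ≡⟨ arcsOver-suc a ⟩
    arcsOver (toℕ a) + up a           ≡⟨ cong (λ m → arcsOver (toℕ a) + m) (𝟙-no a≮πa (a F.<? π a)) ⟩
    arcsOver (toℕ a) + 0              ≡⟨ +-identityʳ _ ⟩
    arcsOver (toℕ a)                  ∎
    where open ≤-Reasoning

  arc⇒Tunnel : ∀ {a} → a F.< π a → Tunnel arcsOver (toℕ a) (suc (toℕ (π a)))
  arc⇒Tunnel a<πa = s≤s a<πa , sym (arcsOver-after-arc a<πa) ,
                    λ k a<k k<πa+1 → arcsOver-under-arc a<πa a<k (ℕ.s≤s⁻¹ k<πa+1)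

  Tunnel⇒arc : ∀ {a j} → Tunnel arcsOver (toℕ a) j → a F.< π a × j ≡ suc (toℕ (π a))
  Tunnel⇒arc {a} {j} (2+a≤j , level≡ , above) = a<πa , end≡
    where
    a<πa : a F.< π a
    a<πa with a F.<? π a
    ... | yes a<πa = a<πa
    ... | no a≮πa = ⊥-elim (<-irrefl refl (<-≤-trans (above (suc (toℕ a)) ≤-refl 2+a≤j) (arcsOver-after-non-left-end a≮πa)))
    end≡ : j ≡ suc (toℕ (π a))
    end≡ with <-cmp j (suc (toℕ (π a)))
    ... | tri≈ _ j≡ _ = j≡
    ... | tri< j<πa+1 _ _ = ⊥-elim (<-irrefl level≡ (arcsOver-under-arc a<πa (<-trans (n<1+n _) 2+a≤j) (ℕ.s≤s⁻¹ j<πa+1)))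
    ... | tri> _ _ πa+1<j = ⊥-elim (<-irrefl (sym (arcsOver-after-arc a<πa)) (above _ (m<n⇒m<1+n a<πa) πa+1<j))

  count-tunnels : {T : ℕ → ℕ → Set} (T? : ∀ i j → Dec (T i j)) →
    (∀ {i j} → j ≤ n → T i j → Tunnel arcsOver i j) → (∀ {i j} → j ≤ n → Tunnel arcsOver i j → T i j) →
    ∑[ i < suc n ] ∑[ j < suc n ] 𝟙 (T? (toℕ i) (toℕ j)) ≡ ∑[ a < n ] up a
  count-tunnels {T} T? T⇒Tunnel Tunnel⇒T = begin
    ∑[ i < suc n ] tunnelsFrom (toℕ i)
      ≡⟨ sum-init-last {n} (tunnelsFrom ∘ toℕ) ⟩
    ∑[ a < n ] tunnelsFrom (toℕ (F.inject₁ a)) + tunnelsFrom (toℕ (F.fromℕ n))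
      ≡⟨ cong₂ _+_ (sum-cong-≗ {n} (λ a → trans (cong tunnelsFrom (FP.toℕ-inject₁ a)) (tunnelsFrom-arc a)))
                   (trans (cong tunnelsFrom (FP.toℕ-fromℕ n)) noTunnelsFrom-n) ⟩
    ∑[ a < n ] up a + 0
      ≡⟨ +-identityʳ _ ⟩
    ∑[ a < n ] up a ∎
    where
    open ≡-Reasoning
    tunnelsFrom : ℕ → ℕ
    tunnelsFrom i = ∑[ j < suc n ] 𝟙 (T? i (toℕ j))
    end≤n : ∀ (j : Fin (suc n)) → toℕ j ≤ n
    end≤n j = ℕ.s≤s⁻¹ (FP.toℕ<n j)
    endsAfterArc : ∀ {a} j → T (toℕ a) (toℕ j) → j ≡ F.suc (π a)
    endsAfterArc j t = FP.toℕ-injective (proj₂ (Tunnel⇒arc (T⇒Tunnel (end≤n j) t)))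
    tunnelsFrom-arc : ∀ a → tunnelsFrom (toℕ a) ≡ up a
    tunnelsFrom-arc a = trans
      (∑-supported-at (F.suc (π a)) (λ j j≢ → 𝟙-no (j≢ ∘ endsAfterArc j) (T? (toℕ a) (toℕ j))))
      (𝟙-cong (proj₁ ∘ Tunnel⇒arc ∘ T⇒Tunnel (FP.toℕ<n (π a))) (Tunnel⇒T (FP.toℕ<n (π a)) ∘ arc⇒Tunnel)
              (T? (toℕ a) (suc (toℕ (π a)))) (a F.<? π a))
    noTunnelsFrom-n : tunnelsFrom n ≡ 0
    noTunnelsFrom-n = ∑-zero (λ j → 𝟙-no (λ t → tooLong (proj₁ (T⇒Tunnel (end≤n j) t)) (end≤n j)) (T? n (toℕ j)))
      where
      tooLong : ∀ {j} → 2 + n ≤ j → j ≤ n → ⊥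
      tooLong 2+n≤j j≤n = <-irrefl refl (≤-trans 2+n≤j (≤-trans j≤n (n≤1+n n)))

pos-balance : ∀ a b u v → a + v ≡ b + u → + b ℤ.+ (+ u - + v) ≡ + a
pos-balance a b u v a+v≡b+u = begin
  + b ℤ.+ (+ u - + v)          ≡⟨ ℤP.+-assoc (+ b) (+ u) (ℤ.- + v) ⟨
  + b ℤ.+ + u - + v            ≡⟨ cong (_- + v) (trans (cong +_ a+v≡b+u) (ℤP.pos-+ b u)) ⟨
  + (a + v) - + v              ≡⟨ cong (_- + v) (ℤP.pos-+ a v) ⟩
  + a ℤ.+ + v - + v            ≡⟨ ℤP.+-assoc (+ a) (+ v) (ℤ.- + v) ⟩
  + a ℤ.+ (+ v - + v)          ≡⟨ cong (λ z → + a ℤ.+ z) (ℤP.+-inverseʳ (+ v)) ⟩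
  + a ℤ.+ 0ℤ                   ≡⟨ ℤP.+-identityʳ (+ a) ⟩
  + a                          ∎
  where open ≡-Reasoning

module PathOfInvolution {n : ℕ} (π : Fin n → Fin n) (involutive : IsInvolution π) (avoids : Avoids3412 π) where

  open NonCrossing π involutive avoids

  Ψ≡tabulate : Ψ π ≡ tabulate (stepOf π)
  Ψ≡tabulate = LP.map-tabulate (λ i → i) (stepOf π)

  length-Ψ : length (Ψ π) ≡ n
  length-Ψ = trans (cong length Ψ≡tabulate) (LP.length-tabulate (stepOf π))

  stepVal-stepOf : ∀ k → stepVal (stepOf π k) ≡ + up k - + down k
  stepVal-stepOf k with π k FP.≟ k
  ... | yes πk≡k = sym (cong₂ (λ u d → + u - + d) (𝟙-no (λ k<πk → <-irrefl (cong toℕ (sym πk≡k)) k<πk) (k F.<? π k))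
                                                   (𝟙-no (λ πk<k → <-irrefl (cong toℕ πk≡k) πk<k) (π k F.<? k)))
  ... | no πk≢k with k F.<? π k
  ...   | yes k<πk = sym (cong (λ d → + 1 - + d) (𝟙-no (<-asym k<πk) (π k F.<? k)))
  ...   | no k≮πk = sym (cong (λ d → + 0 - + d) (𝟙-yes (≤∧≢⇒< (≮⇒≥ k≮πk) (πk≢k ∘ FP.toℕ-injective)) (π k F.<? k)))

  height-Ψ : ∀ {k} → k ≤ n → height (Ψ π) k ≡ + arcsOver k
  height-Ψ {zero} _ = cong +_ (sym arcsOver-0)
  height-Ψ {suc k} k<n = begin
    height (Ψ π) (suc k)                               ≡⟨ cong (height (Ψ π) ∘ suc) c≡k ⟨
    height (Ψ π) (suc (toℕ c))                         ≡⟨ cong (λ d → height d (suc (toℕ c))) Ψ≡tabulate ⟩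
    height (tabulate (stepOf π)) (suc (toℕ c))         ≡⟨ height-tabulate-suc (stepOf π) c ⟩
    height (tabulate (stepOf π)) (toℕ c) ℤ.+ stepVal (stepOf π c)
      ≡⟨ cong₂ ℤ._+_ (cong (λ d → height d (toℕ c)) (sym Ψ≡tabulate)) (stepVal-stepOf c) ⟩
    height (Ψ π) (toℕ c) ℤ.+ (+ up c - + down c)
      ≡⟨ cong (ℤ._+ (+ up c - + down c)) heightAt-c ⟩
    + arcsOver (toℕ c) ℤ.+ (+ up c - + down c)         ≡⟨ pos-balance _ _ _ _ (arcsOver-suc c) ⟩
    + arcsOver (suc (toℕ c))                           ≡⟨ cong (+_ ∘ arcsOver ∘ suc) c≡k ⟩
    + arcsOver (suc k)                                 ∎
    where
    open ≡-Reasoning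
    c : Fin n
    c = fromℕ< k<n
    c≡k : toℕ c ≡ k
    c≡k = FP.toℕ-fromℕ< k<n
    heightAt-c : height (Ψ π) (toℕ c) ≡ + arcsOver (toℕ c)
    heightAt-c = subst (λ m → height (Ψ π) m ≡ + arcsOver m) (sym c≡k) (height-Ψ (<⇒≤ k<n))

  -- Twice the area: each arc spanning k is counted at k and at k + 1.
  twiceArea-Ψ : twiceArea (Ψ π) ≡ + (∑[ k < n ] arcsOver (toℕ k) + ∑[ k < n ] arcsOver (toℕ k))
  twiceArea-Ψ = begin
    twiceArea (Ψ π)
      ≡⟨ cong (λ m → foldr ℤ._+_ 0ℤ (map (λ k → height (Ψ π) k ℤ.+ height (Ψ π) (suc k)) (upTo m))) length-Ψ ⟩
    foldr ℤ._+_ 0ℤ (map (λ k → height (Ψ π) k ℤ.+ height (Ψ π) (suc k)) (upTo n))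
      ≡⟨ foldr-upTo n _ (λ k → arcsOver k + arcsOver (suc k))
           (λ {k} k<n → trans (cong₂ ℤ._+_ (height-Ψ (<⇒≤ k<n)) (height-Ψ k<n))
                              (sym (ℤP.pos-+ (arcsOver k) (arcsOver (suc k))))) ⟩
    + ∑[ k < n ] (arcsOver (toℕ k) + arcsOver (suc (toℕ k)))
      ≡⟨ cong +_ (∑-distrib-+ {n} (arcsOver ∘ toℕ) (arcsOver ∘ suc ∘ toℕ)) ⟩
    + (∑[ k < n ] arcsOver (toℕ k) + ∑[ k < n ] arcsOver (suc (toℕ k)))
      ≡⟨ cong (λ s → + (∑[ k < n ] arcsOver (toℕ k) + s)) shifted ⟩
    + (∑[ k < n ] arcsOver (toℕ k) + ∑[ k < n ] arcsOver (toℕ k)) ∎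
    where
    open ≡-Reasoning
    shifted : ∑[ k < n ] arcsOver (suc (toℕ k)) ≡ ∑[ k < n ] arcsOver (toℕ k)
    shifted = begin
      ∑[ k < n ] arcsOver (suc (toℕ k))                 ≡⟨ +-identityʳ _ ⟨
      ∑[ k < n ] arcsOver (suc (toℕ k)) + 0             ≡⟨ cong (λ m → ∑[ k < n ] arcsOver (suc (toℕ k)) + m) arcsOver-0 ⟨
      ∑[ k < n ] arcsOver (suc (toℕ k)) + arcsOver 0    ≡⟨ ∑-shift n arcsOver ⟩
      ∑[ k < n ] arcsOver (toℕ k) + arcsOver n          ≡⟨ cong (λ m → ∑[ k < n ] arcsOver (toℕ k) + m) arcsOver-n ⟩
      ∑[ k < n ] arcsOver (toℕ k) + 0                   ≡⟨ +-identityʳ _ ⟩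
      ∑[ k < n ] arcsOver (toℕ k)                       ∎

  inv-as-sum : inv π ≡ ∑[ i < n ] ∑[ j < n ] 𝟙 (inversion? i j)
  inv-as-sum = count-pairs {n} _

  nonTrivialTunnels-Ψ : nonTrivialTunnels (Ψ π) ≡ ∑[ a < n ] up a
  nonTrivialTunnels-Ψ = begin
    nonTrivialTunnels (Ψ π)
      ≡⟨ count-latticePairs (length (Ψ π)) (λ (i , j) → nonTrivialTunnel? (Ψ π) i j) ⟩
    ∑[ i < suc (length (Ψ π)) ] ∑[ j < suc (length (Ψ π)) ] 𝟙 (nonTrivialTunnel? (Ψ π) (toℕ i) (toℕ j))
      ≡⟨ cong (λ m → ∑[ i < suc m ] ∑[ j < suc m ] 𝟙 (nonTrivialTunnel? (Ψ π) (toℕ i) (toℕ j))) length-Ψ ⟩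
    ∑[ i < suc n ] ∑[ j < suc n ] 𝟙 (nonTrivialTunnel? (Ψ π) (toℕ i) (toℕ j))
      ≡⟨ count-tunnels (nonTrivialTunnel? (Ψ π)) (tunnel⇒Tunnel (Ψ π) arcsOver height-Ψ)
                                                 (Tunnel⇒tunnel (Ψ π) arcsOver height-Ψ) ⟩
    ∑[ a < n ] up a ∎
    where open ≡-Reasoning

lemma3p1 : (n : ℕ) (π : Fin n → Fin n) → IsInvolution π → Avoids3412 π →
    + inv π ≡ twiceArea (Ψ π) - + nonTrivialTunnels (Ψ π)
lemma3p1 n π involutive avoids = begin
  + inv π                                       ≡⟨ pos-balance (inv π) 0 (S + S) #arcs inv+arcs≡2S ⟨
  + 0 ℤ.+ (+ (S + S) - + #arcs)                 ≡⟨ ℤP.+-identityˡ _ ⟩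
  + (S + S) - + #arcs                           ≡⟨ cong₂ _-_ twiceArea-Ψ (cong +_ nonTrivialTunnels-Ψ) ⟨
  twiceArea (Ψ π) - + nonTrivialTunnels (Ψ π)   ∎
  where
  open NonCrossing π involutive avoids
  open PathOfInvolution π involutive avoids
  open ≡-Reasoning
  S #arcs : ℕ
  S = ∑[ k < n ] arcsOver (toℕ k)
  #arcs = ∑[ a < n ] up a
  inv+arcs≡2S : inv π + #arcs ≡ S + S
  inv+arcs≡2S = trans (cong₂ _+_ inv-as-sum ∑up≡∑down) inversions+downs
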